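{- Let $X$ be a finite quandle with connected components $C_1,\dots,C_k$, let $s=(x_1,\dots,x_n)\in X^n$, and let $n_j=|\{i:x_i\in C_j\}|$. If $n_j>|C_j|$ for some $1\le j\le k$, then the image in $S_n$ of the stabilizer of $s$ in $B_n$ is not contained in $A_n$.
   Context: Quandle: set with $(x,y)\mapsto x^y$, each $x\mapsto x^y$ bijective, $(z^x)^y=(z^y)^{x^y}$, $x^x=x$. Connected components: orbits of the group generated by the maps $x\mapsto x^y$. $B_n$ acts on $X^n$ on the right by $(\dots,c_i,c_{i+1},\dots)^{\sigma_i}=(\dots,c_{i+1},c_i^{c_{i+1}},\dots)$; $B_n\to S_n$ sends $\sigma_i\mapsto(i\ i+1)$. -}

module Defs where

open import Data.Nat using (ℕ; zero; suc; _<_; _*_)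
open import Data.Nat.Properties using (<-trans; n<1+n)
open import Data.Fin using (Fin; toℕ; fromℕ<)
open import Data.Fin.Subset using (Subset; _∈_; ∣_∣)
open import Data.Fin.Permutation using (Permutation′; transpose; _∘ₚ_; id; _≈_)
open import Data.Vec using (tabulate; lookup)
open import Data.Bool using (Bool; true; false)
open import Data.List using (List; []; _∷_; length)
open import Data.Product using (Σ; ∃; _×_; _,_)
open import Relation.Binary.PropositionalEquality using (_≡_; _≢_)
open import Relation.Nullary using (yes; no; ¬_)
import Data.Nat as ℕ

-- A quandle structure on the finite set Fin m (every finite quandle is
-- isomorphic to one of these).  x ▷ y stands for x^y;  _◁ y is the
-- two-sided inverse of _▷ y (so each map x ↦ x^y is bijective).
record Quandle (m : ℕ) : Set where
  infixl 7 _▷_ _◁_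
  field
    _▷_ : Fin m → Fin m → Fin m
    _◁_ : Fin m → Fin m → Fin m
    ◁▷ : ∀ x y → (x ◁ y) ▷ y ≡ x
    ▷◁ : ∀ x y → (x ▷ y) ◁ y ≡ x
    selfdist : ∀ x y z → (z ▷ x) ▷ y ≡ (z ▷ y) ▷ (x ▷ y)
    idem : ∀ x → x ▷ x ≡ x

module _ {m : ℕ} (Q : Quandle m) where
  open Quandle Q

  data Conn (x : Fin m) : Fin m → Set where
    conn-refl : Conn x x
    conn-fwd  : ∀ {y} z → Conn x y → Conn x (y ▷ z)
    conn-bwd  : ∀ {y} z → Conn x y → Conn x (y ◁ z)

  IsComponent : Subset m → Set
  IsComponent C =
    (∃ λ x → x ∈ C) ×
    (∀ x y → x ∈ C → y ∈ C → Conn x y) ×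
    (∀ x y → x ∈ C → Conn x y → y ∈ C)

  countIn : ∀ {n} → Subset m → (Fin n → Fin m) → ℕ
  countIn C s = ∣ tabulate (λ i → lookup C (s i)) ∣

-- Braid words in B_n: the letter (i , inv) is σ_{i+1} (inv = false) or
-- σ_{i+1}⁻¹ (inv = true), acting on positions i and i+1 (0-based).
record Letter (n : ℕ) : Set where
  constructor letter
  field
    i   : ℕ
    i+1<n : suc i < n
    inv : Bool

pos₀ : ∀ {n} → Letter n → Fin n
pos₀ (letter i lt _) = fromℕ< (<-trans (n<1+n i) lt)

pos₁ : ∀ {n} → Letter n → Fin n
pos₁ (letter i lt _) = fromℕ< lt

BraidWord : ℕ → Set
BraidWord n = List (Letter n)

module _ {m : ℕ} (Q : Quandle m) where
  open Quandle Q

  actLetter : ∀ {n} → (Fin n → Fin m) → Letter n → (Fin n → Fin m)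
  actLetter s l@(letter i _ false) k with toℕ k ℕ.≟ i | toℕ k ℕ.≟ suc i
  ... | yes _ | _     = s (pos₁ l)
  ... | no _  | yes _ = s (pos₀ l) ▷ s (pos₁ l)
  ... | no _  | no _  = s k
  actLetter s l@(letter i _ true) k with toℕ k ℕ.≟ i | toℕ k ℕ.≟ suc i
  ... | yes _ | _     = s (pos₁ l) ◁ s (pos₀ l)
  ... | no _  | yes _ = s (pos₀ l)
  ... | no _  | no _  = s k

  act : ∀ {n} → (Fin n → Fin m) → BraidWord n → (Fin n → Fin m)
  act s []      = s
  act s (l ∷ w) = act (actLetter s l) w

-- The image of a braid word under B_n → S_n, σ_i^{±1} ↦ (i i+1).
-- (π ∘ₚ ρ means: first π, then ρ.)
toPerm : ∀ {n} → BraidWord n → Permutation′ n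
toPerm []      = id
toPerm (l ∷ w) = transpose (pos₀ l) (pos₁ l) ∘ₚ toPerm w

prodTransp : ∀ {n} → List (Fin n × Fin n) → Permutation′ n
prodTransp []            = id
prodTransp ((a , b) ∷ t) = transpose a b ∘ₚ prodTransp t

data AllDistinctPairs {n : ℕ} : List (Fin n × Fin n) → Set where
  []  : AllDistinctPairs []
  _∷_ : ∀ {a b t} → a ≢ b → AllDistinctPairs t → AllDistinctPairs ((a , b) ∷ t)

InAlt : ∀ {n} → Permutation′ n → Set
InAlt {n} π = Σ (List (Fin n × Fin n)) λ t →
  AllDistinctPairs t × (∃ λ k → length t ≡ 2 * k) × (prodTransp t ≈ π)

-- There are more entries of s in C than elements of C, so two coincide: s a = s b with a < b. The braid
-- γ = σ_{b-1} ⋯ σ_{a+1} carries the value at b down to position a+1, next to the equal value at a, and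
-- σ_a fixes a tuple whose entries a, a+1 agree because x ▷ x = x. Hence β = γ σ_a γ⁻¹ stabilises s.
-- Its image in S_n is a product of 2|γ|+1 transpositions, while every transposition changes the parity
-- of the number of inversions (an adjacent one changes exactly one inversion, and any other is a
-- conjugate of an adjacent one by adjacent ones); so it is not a product of an even number of them.

module Submission where

open import Defs
open import Data.Nat as ℕ using (ℕ; zero; suc; _<_; _<′_; _<ᵇ_; ≤′-reflexive; ≤′-step; z<s; s<s)
import Data.Nat.Properties as ℕ
open import Data.Fin as Fin using (Fin; zero; suc; toℕ; inject₁)
open import Data.Fin.Properties using (toℕ-injective; toℕ-inject₁; toℕ-fromℕ<; toℕ<n; <⇒≢; <-cmp; _≟_; any?)
open import Data.Fin.Subset using (Subset; ∣_∣; inside; outside)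
import Data.Fin.Permutation.Components as PC
open import Data.Fin.Permutation using (Permutation′; _⟨$⟩ʳ_; transpose; _∘ₚ_; id; _≈_; lift₀-transpose)
open import Data.Bool using (if_then_else_; true; false; not)
open import Data.Parity using (Parity; 0ℙ; 1ℙ; _⁻¹; _+_)
open import Data.Parity.Properties
  using (⁻¹-involutive; ⁻¹-selfInverse; p≢p⁻¹; p+p⁻¹≡1ℙ; +-assoc; +-commutativeSemigroup; suc-homo-⁻¹; +-homo-+; *-homo-*)
open import Algebra.Properties.CommutativeSemigroup +-commutativeSemigroup using (x∙yz≈y∙xz)
open import Data.List using (List; []; _∷_; [_]; length; map; reverse; _++_)
open import Data.List.Properties using (length-++; length-map; length-reverse; unfold-reverse)
open import Data.Vec using (_∷_; lookup; tabulate; _[_]≔_)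
open import Data.Vec.Properties using (tabulate-cong; lookup∘update′)
open import Data.Product using (Σ; ∃; ∃₂; _×_; _,_)
open import Data.Empty using (⊥-elim)
open import Function using (_∘_)
open import Function.Bundles using (Injection)
open import Function.Properties.Inverse using (↔⇒↣)
open import Relation.Binary using (tri<; tri≈; tri>)
open import Relation.Binary.PropositionalEquality hiding ([_])
open import Relation.Nullary using (¬_; Dec; yes; no)
open import Relation.Nullary.Decidable using (dec-true; dec-false)

private variable n : ℕ

-- Parity of permutations

lessParity : ℕ → ℕ → Parity
lessParity x y = if x <ᵇ y then 1ℙ else 0ℙ

lessParity-swap : ∀ {x y} → x ≢ y → lessParity x y ≡ lessParity y x ⁻¹
lessParity-swap {zero}  {zero}  x≢y = ⊥-elim (x≢y refl)
lessParity-swap {zero}  {suc y} _   = refl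
lessParity-swap {suc x} {zero}  _   = refl
lessParity-swap {suc x} {suc y} x≢y = lessParity-swap (x≢y ∘ cong suc)

parityBelow : ℕ → (Fin n → ℕ) → Parity
parityBelow {zero}  x g = 0ℙ
parityBelow {suc n} x g = lessParity (g zero) x + parityBelow x (g ∘ suc)

inversionParity : (Fin n → ℕ) → Parity
inversionParity {zero}  f = 0ℙ
inversionParity {suc n} f = parityBelow (f zero) (f ∘ suc) + inversionParity (f ∘ suc)

parityBelow-cong : ∀ x {g h : Fin n → ℕ} → g ≗ h → parityBelow x g ≡ parityBelow x h
parityBelow-cong {zero}  x g≗h = refl
parityBelow-cong {suc n} x g≗h =
  cong₂ _+_ (cong (λ y → lessParity y x) (g≗h zero)) (parityBelow-cong x (g≗h ∘ suc))

inversionParity-cong : {f g : Fin n → ℕ} → f ≗ g → inversionParity f ≡ inversionParity g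
inversionParity-cong {zero}  f≗g = refl
inversionParity-cong {suc n} {f} {g} f≗g =
  cong₂ _+_ (trans (cong (λ x → parityBelow x (f ∘ suc)) (f≗g zero)) (parityBelow-cong (g zero) (f≗g ∘ suc)))
            (inversionParity-cong (f≗g ∘ suc))

transpose-lift : ∀ (a b : Fin n) → PC.transpose (suc a) (suc b) ∘ suc ≗ suc ∘ PC.transpose a b
transpose-lift a b k = lift₀-transpose a b (suc k)

parityBelow-transpose-adjacent : ∀ x (g : Fin n → ℕ) {a b} → suc (toℕ a) ≡ toℕ b →
  parityBelow x (g ∘ PC.transpose a b) ≡ parityBelow x g
parityBelow-transpose-adjacent x g {zero}  {suc zero}    _ =
  x∙yz≈y∙xz (lessParity (g (suc zero)) x) (lessParity (g zero) x) (parityBelow x (λ i → g (suc (suc i))))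
parityBelow-transpose-adjacent x g {suc a} {suc b}       e = cong (lessParity (g zero) x +_) (begin
  parityBelow x (g ∘ PC.transpose (suc a) (suc b) ∘ suc) ≡⟨ parityBelow-cong x (cong g ∘ transpose-lift a b) ⟩
  parityBelow x (g ∘ suc ∘ PC.transpose a b)             ≡⟨ parityBelow-transpose-adjacent x (g ∘ suc) (ℕ.suc-injective e) ⟩
  parityBelow x (g ∘ suc)                                ∎)
  where open ≡-Reasoning

-- Throughout, p ⁻¹ and 1ℙ + p are definitionally equal.
inversionParity-transpose-adjacent : ∀ (f : Fin n → ℕ) {a b} → suc (toℕ a) ≡ toℕ b → f a ≢ f b →
  inversionParity (f ∘ PC.transpose a b) ≡ inversionParity f ⁻¹
inversionParity-transpose-adjacent f {zero} {suc zero} _ fa≢fb = begin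
  (lessParity f₀ f₁ + B) + (A + R)        ≡⟨ +-assoc (lessParity f₀ f₁) B (A + R) ⟩
  lessParity f₀ f₁ + (B + (A + R))        ≡⟨ cong (lessParity f₀ f₁ +_) (x∙yz≈y∙xz B A R) ⟩
  lessParity f₀ f₁ + (A + (B + R))        ≡⟨ cong (_+ (A + (B + R))) (lessParity-swap fa≢fb) ⟩
  (1ℙ + lessParity f₁ f₀) + (A + (B + R)) ≡⟨ +-assoc 1ℙ (lessParity f₁ f₀) (A + (B + R)) ⟩
  (lessParity f₁ f₀ + (A + (B + R))) ⁻¹   ≡⟨ cong _⁻¹ (+-assoc (lessParity f₁ f₀) A (B + R)) ⟨
  ((lessParity f₁ f₀ + A) + (B + R)) ⁻¹   ∎
  where
  open ≡-Reasoning
  f₀ = f zero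
  f₁ = f (suc zero)
  rest = λ i → f (suc (suc i))
  A = parityBelow f₀ rest
  B = parityBelow f₁ rest
  R = inversionParity rest
inversionParity-transpose-adjacent f {suc a} {suc b} e fa≢fb = begin
  parityBelow (f zero) (f ∘ τ ∘ suc) + inversionParity (f ∘ τ ∘ suc)
    ≡⟨ cong₂ _+_ (parityBelow-cong (f zero) lift) (inversionParity-cong lift) ⟩
  parityBelow (f zero) (f ∘ suc ∘ τ′) + inversionParity (f ∘ suc ∘ τ′)
    ≡⟨ cong₂ _+_ (parityBelow-transpose-adjacent (f zero) (f ∘ suc) e′)
                 (inversionParity-transpose-adjacent (f ∘ suc) e′ fa≢fb) ⟩
  parityBelow (f zero) (f ∘ suc) + (1ℙ + inversionParity (f ∘ suc))
    ≡⟨ x∙yz≈y∙xz (parityBelow (f zero) (f ∘ suc)) 1ℙ (inversionParity (f ∘ suc)) ⟩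
  (parityBelow (f zero) (f ∘ suc) + inversionParity (f ∘ suc)) ⁻¹ ∎
  where
  open ≡-Reasoning
  τ = PC.transpose (suc a) (suc b)
  τ′ = PC.transpose a b
  e′ = ℕ.suc-injective e
  lift : f ∘ τ ∘ suc ≗ f ∘ suc ∘ τ′
  lift = cong f ∘ transpose-lift a b

module _ (a b : Fin n) where

  transpose-matchˡ : PC.transpose a b a ≡ b
  transpose-matchˡ rewrite dec-true (a ≟ a) refl = refl

  transpose-matchʳ : PC.transpose a b b ≡ a
  transpose-matchʳ with b ≟ a
  ... | yes b≡a = b≡a
  ... | no b≢a rewrite dec-true (b ≟ b) refl = refl

  transpose-other : ∀ {k} → k ≢ a → k ≢ b → PC.transpose a b k ≡ k
  transpose-other {k} k≢a k≢b rewrite dec-false (k ≟ a) k≢a | dec-false (k ≟ b) k≢b = refl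

  transpose-unique : (g : Fin n → Fin n) → g a ≡ b → g b ≡ a → (∀ {k} → k ≢ a → k ≢ b → g k ≡ k) →
    PC.transpose a b ≗ g
  transpose-unique g ga gb gk k = by-cases (k ≟ a) (k ≟ b)
    where
    by-cases : Dec (k ≡ a) → Dec (k ≡ b) → PC.transpose a b k ≡ g k
    by-cases (yes k≡a) _ =
      trans (cong (PC.transpose a b) k≡a) (trans transpose-matchˡ (sym (trans (cong g k≡a) ga)))
    by-cases (no _) (yes k≡b) =
      trans (cong (PC.transpose a b) k≡b) (trans transpose-matchʳ (sym (trans (cong g k≡b) gb)))
    by-cases (no k≢a) (no k≢b) = trans (transpose-other k≢a k≢b) (sym (gk k≢a k≢b))

transpose-comm : (a b : Fin n) → PC.transpose a b ≗ PC.transpose b a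
transpose-comm a b =
  transpose-unique a b _ (transpose-matchʳ b a) (transpose-matchˡ b a) (λ k≢a k≢b → transpose-other b a k≢b k≢a)

transpose-conjugate : {a b c : Fin n} → a ≢ b → c ≢ a → c ≢ b →
  PC.transpose a b ≗ PC.transpose c b ∘ PC.transpose a c ∘ PC.transpose c b
transpose-conjugate {n} {a} {b} {c} a≢b c≢a c≢b = transpose-unique a b _ at-a at-b fixes
  where
  open ≡-Reasoning
  τ = PC.transpose c b ∘ PC.transpose a c ∘ PC.transpose c b
  at-a : τ a ≡ b
  at-a = begin
    τ a ≡⟨ cong (PC.transpose c b ∘ PC.transpose a c) (transpose-other c b (c≢a ∘ sym) a≢b) ⟩
    PC.transpose c b (PC.transpose a c a) ≡⟨ cong (PC.transpose c b) (transpose-matchˡ a c) ⟩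
    PC.transpose c b c ≡⟨ transpose-matchˡ c b ⟩
    b ∎
  at-b : τ b ≡ a
  at-b = begin
    τ b ≡⟨ cong (PC.transpose c b ∘ PC.transpose a c) (transpose-matchʳ c b) ⟩
    PC.transpose c b (PC.transpose a c c) ≡⟨ cong (PC.transpose c b) (transpose-matchʳ a c) ⟩
    PC.transpose c b a ≡⟨ transpose-other c b (c≢a ∘ sym) a≢b ⟩
    a ∎
  at-c : τ c ≡ c
  at-c = begin
    τ c ≡⟨ cong (PC.transpose c b ∘ PC.transpose a c) (transpose-matchˡ c b) ⟩
    PC.transpose c b (PC.transpose a c b) ≡⟨ cong (PC.transpose c b) (transpose-other a c (a≢b ∘ sym) (c≢b ∘ sym)) ⟩
    PC.transpose c b b ≡⟨ transpose-matchʳ c b ⟩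
    c ∎
  fixes : ∀ {k} → k ≢ a → k ≢ b → τ k ≡ k
  fixes {k} k≢a k≢b = by-cases (k ≟ c)
    where
    by-cases : Dec (k ≡ c) → τ k ≡ k
    by-cases (yes k≡c) = trans (cong τ k≡c) (trans at-c (sym k≡c))
    by-cases (no k≢c) = begin
      τ k ≡⟨ cong (PC.transpose c b ∘ PC.transpose a c) (transpose-other c b k≢c k≢b) ⟩
      PC.transpose c b (PC.transpose a c k) ≡⟨ cong (PC.transpose c b) (transpose-other a c k≢a k≢c) ⟩
      PC.transpose c b k ≡⟨ transpose-other c b k≢c k≢b ⟩
      k ∎

permParity : Permutation′ n → Parity
permParity π = inversionParity (λ i → toℕ (π ⟨$⟩ʳ i))

permParity-cong : (π ρ : Permutation′ n) → π ≈ ρ → permParity π ≡ permParity ρ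
permParity-cong π ρ π≈ρ = inversionParity-cong (cong toℕ ∘ π≈ρ)

permParity-transpose-adjacent : ∀ (π : Permutation′ n) {a b} → suc (toℕ a) ≡ toℕ b →
  permParity (transpose a b ∘ₚ π) ≡ permParity π ⁻¹
permParity-transpose-adjacent π {a} {b} e =
  inversionParity-transpose-adjacent (λ i → toℕ (π ⟨$⟩ʳ i)) e
    (<⇒≢ a<b ∘ Injection.injective (↔⇒↣ π) ∘ toℕ-injective)
  where
  a<b : a Fin.< b
  a<b = subst (toℕ a <_) e ℕ.≤-refl

permParity-transpose-< : ∀ (π : Permutation′ n) {a b k} → toℕ b ≡ k → toℕ a <′ k →
  permParity (transpose a b ∘ₚ π) ≡ permParity π ⁻¹
permParity-transpose-< π b≡k (≤′-reflexive a⋖k) = permParity-transpose-adjacent π (trans a⋖k (sym b≡k))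
permParity-transpose-< π {a} {suc j} b≡k (≤′-step a<′k) = begin
  permParity (transpose a b ∘ₚ π)
    ≡⟨ permParity-cong (transpose a b ∘ₚ π) (transpose c b ∘ₚ transpose a c ∘ₚ transpose c b ∘ₚ π)
                       (cong (π ⟨$⟩ʳ_) ∘ transpose-conjugate a≢b c≢a c≢b) ⟩
  permParity (transpose c b ∘ₚ transpose a c ∘ₚ transpose c b ∘ₚ π)
    ≡⟨ permParity-transpose-adjacent (transpose a c ∘ₚ transpose c b ∘ₚ π) c⋖b ⟩
  permParity (transpose a c ∘ₚ transpose c b ∘ₚ π) ⁻¹
    ≡⟨ cong _⁻¹ (permParity-transpose-< (transpose c b ∘ₚ π) c≡k a<′k) ⟩
  permParity (transpose c b ∘ₚ π) ⁻¹ ⁻¹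
    ≡⟨ ⁻¹-involutive _ ⟩
  permParity (transpose c b ∘ₚ π)
    ≡⟨ permParity-transpose-adjacent π c⋖b ⟩
  permParity π ⁻¹ ∎
  where
  open ≡-Reasoning
  b = suc j
  c = inject₁ j
  c⋖b : suc (toℕ c) ≡ toℕ b
  c⋖b = cong suc (toℕ-inject₁ j)
  c≡k = trans (toℕ-inject₁ j) (ℕ.suc-injective b≡k)
  a<c : a Fin.< c
  a<c = subst (toℕ a <_) (sym c≡k) (ℕ.≤′⇒≤ a<′k)
  c<b : c Fin.< b
  c<b = subst (_< toℕ b) (sym (toℕ-inject₁ j)) ℕ.≤-refl
  a≢b = <⇒≢ (ℕ.<-trans a<c c<b)
  c≢a = <⇒≢ a<c ∘ sym
  c≢b = <⇒≢ c<b

permParity-transpose : ∀ (π : Permutation′ n) {a b} → a ≢ b →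
  permParity (transpose a b ∘ₚ π) ≡ permParity π ⁻¹
permParity-transpose π {a} {b} a≢b with <-cmp a b
... | tri< a<b _ _ = permParity-transpose-< π refl (ℕ.<⇒<′ a<b)
... | tri≈ _ a≡b _ = ⊥-elim (a≢b a≡b)
... | tri> _ _ b<a =
  trans (permParity-cong (transpose a b ∘ₚ π) (transpose b a ∘ₚ π) (cong (π ⟨$⟩ʳ_) ∘ transpose-comm a b))
        (permParity-transpose-< π refl (ℕ.<⇒<′ b<a))

parity-suc-+ : ∀ k p → (ℕ.parity k + p) ⁻¹ ≡ ℕ.parity (suc k) + p
parity-suc-+ k p = begin
  1ℙ + (ℕ.parity k + p)      ≡⟨ +-assoc 1ℙ (ℕ.parity k) p ⟨
  (ℕ.parity k) ⁻¹ + p        ≡⟨ cong (_+ p) (⁻¹-selfInverse (suc-homo-⁻¹ k)) ⟩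
  ℕ.parity (suc k) + p       ∎
  where open ≡-Reasoning

permParity-prodTransp : ∀ {n} {t : List (Fin n × Fin n)} → AllDistinctPairs t →
  permParity (prodTransp t) ≡ ℕ.parity (length t) + permParity (id {n})
permParity-prodTransp [] = refl
permParity-prodTransp {n} {(a , b) ∷ t} (a≢b ∷ distinct) =
  trans (permParity-transpose (prodTransp t) a≢b)
        (trans (cong _⁻¹ (permParity-prodTransp distinct)) (parity-suc-+ (length t) (permParity (id {n}))))

permParity-InAlt : ∀ {n} (π : Permutation′ n) → InAlt π → permParity π ≡ permParity (id {n})
permParity-InAlt {n} π (t , distinct , (k , len≡2k) , t≈π) = begin
  permParity π                              ≡⟨ permParity-cong (prodTransp t) π t≈π ⟨
  permParity (prodTransp t)                 ≡⟨ permParity-prodTransp distinct ⟩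
  ℕ.parity (length t) + permParity (id {n}) ≡⟨ cong (λ l → ℕ.parity l + permParity (id {n})) len≡2k ⟩
  ℕ.parity (2 ℕ.* k) + permParity (id {n})  ≡⟨ cong (_+ permParity (id {n})) (*-homo-* 2 k) ⟩
  permParity (id {n})                       ∎
  where open ≡-Reasoning

-- Braid words and their images in S_n

pattern σ i lt = letter i lt false
pattern σ⁻¹ i lt = letter i lt true

letterInverse : Letter n → Letter n
letterInverse (letter i lt inv) = letter i lt (not inv)

braidInverse : BraidWord n → BraidWord n
braidInverse w = reverse (map letterInverse w)

length-braidInverse : (w : BraidWord n) → length (braidInverse w) ≡ length w
length-braidInverse w = trans (length-reverse (map letterInverse w)) (length-map letterInverse w)

toℕ-pos₀ : (l : Letter n) → toℕ (pos₀ l) ≡ Letter.i l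
toℕ-pos₀ (letter i lt _) = toℕ-fromℕ< _

toℕ-pos₁ : (l : Letter n) → toℕ (pos₁ l) ≡ suc (Letter.i l)
toℕ-pos₁ (letter i lt _) = toℕ-fromℕ< lt

pos₀<pos₁ : (l : Letter n) → pos₀ l Fin.< pos₁ l
pos₀<pos₁ l = subst₂ _<_ (sym (toℕ-pos₀ l)) (sym (toℕ-pos₁ l)) ℕ.≤-refl

permParity-toPerm : ∀ {n} (w : BraidWord n) → permParity (toPerm w) ≡ ℕ.parity (length w) + permParity (id {n})
permParity-toPerm [] = refl
permParity-toPerm {n} (l ∷ w) =
  trans (permParity-transpose (toPerm w) (<⇒≢ (pos₀<pos₁ l)))
        (trans (cong _⁻¹ (permParity-toPerm w)) (parity-suc-+ (length w) (permParity (id {n}))))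

odd⇒¬InAlt : ∀ {n} (w : BraidWord n) → ℕ.parity (length w) ≡ 1ℙ → ¬ InAlt (toPerm w)
odd⇒¬InAlt {n} w odd alt = p≢p⁻¹ (permParity (id {n})) (begin
  permParity (id {n})                       ≡⟨ permParity-InAlt (toPerm w) alt ⟨
  permParity (toPerm w)                     ≡⟨ permParity-toPerm w ⟩
  ℕ.parity (length w) + permParity (id {n}) ≡⟨ cong (_+ permParity (id {n})) odd ⟩
  permParity (id {n}) ⁻¹                    ∎)
  where open ≡-Reasoning

parity-length-conjugate : (γ : BraidWord n) (l : Letter n) → ℕ.parity (length (γ ++ l ∷ braidInverse γ)) ≡ 1ℙ
parity-length-conjugate γ l = begin
  ℕ.parity (length (γ ++ l ∷ braidInverse γ))          ≡⟨ cong ℕ.parity (length-++ γ) ⟩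
  ℕ.parity (length γ ℕ.+ suc (length (braidInverse γ))) ≡⟨ cong (λ k → ℕ.parity (length γ ℕ.+ suc k)) (length-braidInverse γ) ⟩
  ℕ.parity (length γ ℕ.+ suc (length γ))               ≡⟨ +-homo-+ (length γ) (suc (length γ)) ⟩
  ℕ.parity (length γ) + ℕ.parity (suc (length γ))      ≡⟨ cong (ℕ.parity (length γ) +_) (⁻¹-selfInverse (suc-homo-⁻¹ (length γ))) ⟨
  ℕ.parity (length γ) + ℕ.parity (length γ) ⁻¹         ≡⟨ p+p⁻¹≡1ℙ (ℕ.parity (length γ)) ⟩
  1ℙ                                                   ∎
  where open ≡-Reasoning

data Slot {n} (l : Letter n) : Fin n → Set where
  at₀ : Slot l (pos₀ l)
  at₁ : Slot l (pos₁ l)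
  elsewhere : ∀ {k} → k ≢ pos₀ l → k ≢ pos₁ l → Slot l k

slot : (l : Letter n) (k : Fin n) → Slot l k
slot l k with k ≟ pos₀ l | k ≟ pos₁ l
... | yes refl | _        = at₀
... | no _     | yes refl = at₁
... | no k≢p₀  | no k≢p₁  = elsewhere k≢p₀ k≢p₁

-- The action of braid words on tuples

module _ {m : ℕ} (Q : Quandle m) where
  open Quandle Q

  private
    Tuple : ℕ → Set
    Tuple n = Fin n → Fin m

  σ-at₀ : ∀ (s : Tuple n) {i} (lt : suc i < n) → actLetter Q s (σ i lt) (pos₀ (σ i lt)) ≡ s (pos₁ (σ i lt))
  σ-at₀ s {i} lt with toℕ (pos₀ (σ i lt)) ℕ.≟ i | toℕ (pos₀ (σ i lt)) ℕ.≟ suc i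
  ... | yes _  | _ = refl
  ... | no ≢i  | _ = ⊥-elim (≢i (toℕ-pos₀ (σ i lt)))

  σ-at₁ : ∀ (s : Tuple n) {i} (lt : suc i < n) →
    actLetter Q s (σ i lt) (pos₁ (σ i lt)) ≡ s (pos₀ (σ i lt)) ▷ s (pos₁ (σ i lt))
  σ-at₁ s {i} lt with toℕ (pos₁ (σ i lt)) ℕ.≟ i | toℕ (pos₁ (σ i lt)) ℕ.≟ suc i
  ... | yes ≡i | _      = ⊥-elim (<⇒≢ (pos₀<pos₁ (σ i lt)) (toℕ-injective (trans (toℕ-pos₀ (σ i lt)) (sym ≡i))))
  ... | no _   | yes _  = refl
  ... | no _   | no ≢1+i = ⊥-elim (≢1+i (toℕ-pos₁ (σ i lt)))

  σ⁻¹-at₀ : ∀ (s : Tuple n) {i} (lt : suc i < n) →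
    actLetter Q s (σ⁻¹ i lt) (pos₀ (σ⁻¹ i lt)) ≡ s (pos₁ (σ⁻¹ i lt)) ◁ s (pos₀ (σ⁻¹ i lt))
  σ⁻¹-at₀ s {i} lt with toℕ (pos₀ (σ⁻¹ i lt)) ℕ.≟ i | toℕ (pos₀ (σ⁻¹ i lt)) ℕ.≟ suc i
  ... | yes _  | _ = refl
  ... | no ≢i  | _ = ⊥-elim (≢i (toℕ-pos₀ (σ⁻¹ i lt)))

  σ⁻¹-at₁ : ∀ (s : Tuple n) {i} (lt : suc i < n) → actLetter Q s (σ⁻¹ i lt) (pos₁ (σ⁻¹ i lt)) ≡ s (pos₀ (σ⁻¹ i lt))
  σ⁻¹-at₁ s {i} lt with toℕ (pos₁ (σ⁻¹ i lt)) ℕ.≟ i | toℕ (pos₁ (σ⁻¹ i lt)) ℕ.≟ suc i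
  ... | yes ≡i | _      = ⊥-elim (<⇒≢ (pos₀<pos₁ (σ⁻¹ i lt)) (toℕ-injective (trans (toℕ-pos₀ (σ⁻¹ i lt)) (sym ≡i))))
  ... | no _   | yes _  = refl
  ... | no _   | no ≢1+i = ⊥-elim (≢1+i (toℕ-pos₁ (σ⁻¹ i lt)))

  actLetter-elsewhere : ∀ (s : Tuple n) l {k} → k ≢ pos₀ l → k ≢ pos₁ l → actLetter Q s l k ≡ s k
  actLetter-elsewhere s l@(σ i lt) {k} k≢p₀ k≢p₁ with toℕ k ℕ.≟ i | toℕ k ℕ.≟ suc i
  ... | yes ≡i | _       = ⊥-elim (k≢p₀ (toℕ-injective (trans ≡i (sym (toℕ-pos₀ l)))))
  ... | no _   | yes ≡1+i = ⊥-elim (k≢p₁ (toℕ-injective (trans ≡1+i (sym (toℕ-pos₁ l)))))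
  ... | no _   | no _    = refl
  actLetter-elsewhere s l@(σ⁻¹ i lt) {k} k≢p₀ k≢p₁ with toℕ k ℕ.≟ i | toℕ k ℕ.≟ suc i
  ... | yes ≡i | _       = ⊥-elim (k≢p₀ (toℕ-injective (trans ≡i (sym (toℕ-pos₀ l)))))
  ... | no _   | yes ≡1+i = ⊥-elim (k≢p₁ (toℕ-injective (trans ≡1+i (sym (toℕ-pos₁ l)))))
  ... | no _   | no _    = refl

  actLetter-cong : ∀ {s t : Tuple n} → s ≗ t → ∀ l → actLetter Q s l ≗ actLetter Q t l
  actLetter-cong s≗t (σ i lt) k with toℕ k ℕ.≟ i | toℕ k ℕ.≟ suc i
  ... | yes _ | _     = s≗t _
  ... | no _  | yes _ = cong₂ _▷_ (s≗t _) (s≗t _)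
  ... | no _  | no _  = s≗t k
  actLetter-cong s≗t (σ⁻¹ i lt) k with toℕ k ℕ.≟ i | toℕ k ℕ.≟ suc i
  ... | yes _ | _     = cong₂ _◁_ (s≗t _) (s≗t _)
  ... | no _  | yes _ = s≗t _
  ... | no _  | no _  = s≗t k

  act-cong : ∀ {s t : Tuple n} → s ≗ t → ∀ w → act Q s w ≗ act Q t w
  act-cong s≗t []      = s≗t
  act-cong s≗t (l ∷ w) = act-cong (actLetter-cong s≗t l) w

  act-++ : ∀ (s : Tuple n) u v → act Q s (u ++ v) ≡ act Q (act Q s u) v
  act-++ s []      v = refl
  act-++ s (l ∷ u) v = act-++ (actLetter Q s l) u v

  actLetter-inverse : ∀ (s : Tuple n) l → actLetter Q (actLetter Q s l) (letterInverse l) ≗ s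
  actLetter-inverse s l@(σ i lt) k with slot l k
  ... | at₀ = begin
    actLetter Q s′ (σ⁻¹ i lt) p₀ ≡⟨ σ⁻¹-at₀ s′ lt ⟩
    s′ p₁ ◁ s′ p₀           ≡⟨ cong₂ _◁_ (σ-at₁ s lt) (σ-at₀ s lt) ⟩
    (s p₀ ▷ s p₁) ◁ s p₁    ≡⟨ ▷◁ (s p₀) (s p₁) ⟩
    s p₀                    ∎
    where
    open ≡-Reasoning
    s′ = actLetter Q s l
    p₀ = pos₀ l
    p₁ = pos₁ l
  ... | at₁ = trans (σ⁻¹-at₁ (actLetter Q s l) lt) (σ-at₀ s lt)
  ... | elsewhere k≢p₀ k≢p₁ =
    trans (actLetter-elsewhere _ (letterInverse l) k≢p₀ k≢p₁) (actLetter-elsewhere s l k≢p₀ k≢p₁)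
  actLetter-inverse s l@(σ⁻¹ i lt) k with slot l k
  ... | at₀ = trans (σ-at₀ (actLetter Q s l) lt) (σ⁻¹-at₁ s lt)
  ... | at₁ = begin
    actLetter Q s′ (σ i lt) p₁ ≡⟨ σ-at₁ s′ lt ⟩
    s′ p₀ ▷ s′ p₁           ≡⟨ cong₂ _▷_ (σ⁻¹-at₀ s lt) (σ⁻¹-at₁ s lt) ⟩
    (s p₁ ◁ s p₀) ▷ s p₀    ≡⟨ ◁▷ (s p₁) (s p₀) ⟩
    s p₁                    ∎
    where
    open ≡-Reasoning
    s′ = actLetter Q s l
    p₀ = pos₀ l
    p₁ = pos₁ l
  ... | elsewhere k≢p₀ k≢p₁ =
    trans (actLetter-elsewhere _ (letterInverse l) k≢p₀ k≢p₁) (actLetter-elsewhere s l k≢p₀ k≢p₁)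

  act-braidInverse : ∀ (s : Tuple n) w → act Q (act Q s w) (braidInverse w) ≗ s
  act-braidInverse s []      k = refl
  act-braidInverse s (l ∷ w) k = begin
    act Q t (reverse (letterInverse l ∷ map letterInverse w)) k
      ≡⟨ cong (λ v → act Q t v k) (unfold-reverse (letterInverse l) (map letterInverse w)) ⟩
    act Q t (braidInverse w ++ [ letterInverse l ]) k
      ≡⟨ cong (λ f → f k) (act-++ t (braidInverse w) [ letterInverse l ]) ⟩
    actLetter Q (act Q t (braidInverse w)) (letterInverse l) k
      ≡⟨ actLetter-cong (act-braidInverse (actLetter Q s l) w) (letterInverse l) k ⟩
    actLetter Q (actLetter Q s l) (letterInverse l) k
      ≡⟨ actLetter-inverse s l k ⟩
    s k ∎
    where
    open ≡-Reasoning
    t = act Q (actLetter Q s l) w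

  σ-fixes : ∀ (s : Tuple n) {i} (lt : suc i < n) → s (pos₀ (σ i lt)) ≡ s (pos₁ (σ i lt)) →
    actLetter Q s (σ i lt) ≗ s
  σ-fixes s {i} lt s₀≡s₁ k with slot (σ i lt) k
  ... | at₀ = trans (σ-at₀ s lt) (sym s₀≡s₁)
  ... | at₁ = trans (σ-at₁ s lt) (trans (cong (_▷ s (pos₁ (σ i lt))) s₀≡s₁) (idem _))
  ... | elsewhere k≢p₀ k≢p₁ = actLetter-elsewhere s (σ i lt) k≢p₀ k≢p₁

  act-conjugate : ∀ (s : Tuple n) γ l → actLetter Q (act Q s γ) l ≗ act Q s γ →
    act Q s (γ ++ l ∷ braidInverse γ) ≗ s
  act-conjugate s γ l fixed k = begin
    act Q s (γ ++ l ∷ braidInverse γ) k                      ≡⟨ cong (λ f → f k) (act-++ s γ (l ∷ braidInverse γ)) ⟩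
    act Q (actLetter Q (act Q s γ) l) (braidInverse γ) k     ≡⟨ act-cong fixed (braidInverse γ) k ⟩
    act Q (act Q s γ) (braidInverse γ) k                     ≡⟨ act-braidInverse s γ k ⟩
    s k                                                      ∎
    where open ≡-Reasoning

  bringAdjacent : ∀ (s : Tuple n) {a b k} → toℕ b ≡ k → toℕ a <′ k → s a ≡ s b →
    ∃ λ γ → ∀ {c} → suc (toℕ a) ≡ toℕ c → act Q s γ a ≡ act Q s γ c
  bringAdjacent s b≡k (≤′-reflexive a⋖k) sa≡sb =
    [] , λ a⋖c → trans sa≡sb (cong s (toℕ-injective (trans b≡k (trans (sym a⋖k) a⋖c))))
  bringAdjacent s {a} {suc j} b≡k (≤′-step a<′k) sa≡sb =
    let γ , adjacent = bringAdjacent (actLetter Q s l) p₀≡k a<′k s′a≡s′p₀ in l ∷ γ , adjacent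
    where
    l = σ (toℕ j) (toℕ<n (suc j))
    p₀≡k = trans (toℕ-pos₀ l) (ℕ.suc-injective b≡k)
    a<p₀ : a Fin.< pos₀ l
    a<p₀ = subst (toℕ a <_) (sym p₀≡k) (ℕ.≤′⇒≤ a<′k)
    s′a≡s′p₀ : actLetter Q s l a ≡ actLetter Q s l (pos₀ l)
    s′a≡s′p₀ = begin
      actLetter Q s l a        ≡⟨ actLetter-elsewhere s l (<⇒≢ a<p₀) (<⇒≢ (ℕ.<-trans a<p₀ (pos₀<pos₁ l))) ⟩
      s a                      ≡⟨ sa≡sb ⟩
      s (suc j)                ≡⟨ cong s (toℕ-injective (sym (toℕ-pos₁ l))) ⟩
      s (pos₁ l)               ≡⟨ σ-at₀ s (toℕ<n (suc j)) ⟨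
      actLetter Q s l (pos₀ l) ∎
      where open ≡-Reasoning

-- Repeated entries

∣p∣≡1+∣p[x]≔outside∣ : ∀ {m} (p : Subset m) {x} → lookup p x ≡ inside → ∣ p ∣ ≡ suc ∣ p [ x ]≔ outside ∣
∣p∣≡1+∣p[x]≔outside∣ (inside ∷ p)  {zero}  _    = refl
∣p∣≡1+∣p[x]≔outside∣ (inside ∷ p)  {suc x} x∈p = cong suc (∣p∣≡1+∣p[x]≔outside∣ p x∈p)
∣p∣≡1+∣p[x]≔outside∣ (outside ∷ p) {suc x} x∈p = ∣p∣≡1+∣p[x]≔outside∣ p x∈p

repeatedEntry : ∀ {m} (C : Subset m) (s : Fin n → Fin m) → ∣ C ∣ < ∣ tabulate (lookup C ∘ s) ∣ →
  ∃₂ λ a b → a Fin.< b × s a ≡ s b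
repeatedEntry {zero} C s ()
repeatedEntry {suc n} C s more with any? (λ k → s zero ≟ s (suc k))
... | yes (k , s₀≡sₖ) = zero , suc k , z<s , s₀≡sₖ
... | no s₀-unrepeated = shift (inTail (lookup C (s zero)) refl more)
  where
  shift : ∃₂ (λ a b → a Fin.< b × s (suc a) ≡ s (suc b)) → ∃₂ λ a b → a Fin.< b × s a ≡ s b
  shift (a , b , a<b , e) = suc a , suc b , s<s a<b , e
  inTail : ∀ side → lookup C (s zero) ≡ side → ∣ C ∣ < ∣ side ∷ tabulate (lookup C ∘ s ∘ suc) ∣ →
    ∃₂ λ a b → a Fin.< b × s (suc a) ≡ s (suc b)
  inTail outside _ more′ = repeatedEntry C (s ∘ suc) more′
  inTail inside s₀∈C more′ = repeatedEntry (C [ s zero ]≔ outside) (s ∘ suc) (begin-strict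
    ∣ C [ s zero ]≔ outside ∣                                 <⟨ ℕ.n<1+n _ ⟩
    suc ∣ C [ s zero ]≔ outside ∣                             ≡⟨ ∣p∣≡1+∣p[x]≔outside∣ C s₀∈C ⟨
    ∣ C ∣                                                     ≤⟨ ℕ.m<1+n⇒m≤n more′ ⟩
    ∣ tabulate (lookup C ∘ s ∘ suc) ∣                         ≡⟨ cong ∣_∣ (tabulate-cong unchanged) ⟨
    ∣ tabulate (lookup (C [ s zero ]≔ outside) ∘ s ∘ suc) ∣   ∎)
    where
    open ℕ.≤-Reasoning
    unchanged : lookup (C [ s zero ]≔ outside) ∘ s ∘ suc ≗ lookup C ∘ s ∘ suc
    unchanged k = lookup∘update′ (λ sₖ≡s₀ → s₀-unrepeated (k , sym sₖ≡s₀)) C outside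

mainTheorem17 : (m : ℕ) (Q : Quandle m) (n : ℕ) (s : Fin n → Fin m)
    (C : Subset m) → IsComponent Q C → ∣ C ∣ < countIn Q C s →
    Σ (BraidWord n) λ β → ((∀ i → act Q s β i ≡ s i) × ¬ InAlt (toPerm β))
-- Connectedness of C is not needed: more entries in C than elements of C already forces a repetition.
mainTheorem17 m Q n s C _ more with repeatedEntry C s more
... | a , b , a<b , sa≡sb with bringAdjacent Q s refl (ℕ.<⇒<′ a<b) sa≡sb
... | γ , adjacent =
  β , act-conjugate Q s γ l l-fixes , odd⇒¬InAlt β (parity-length-conjugate γ l)
  where
  lt = ℕ.≤-<-trans a<b (toℕ<n b)
  l = σ (toℕ a) lt
  β = γ ++ l ∷ braidInverse γ
  t = act Q s γ
  l-fixes : actLetter Q t l ≗ t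
  l-fixes = σ-fixes Q t lt (trans (cong t (toℕ-injective (toℕ-pos₀ l))) (adjacent (sym (toℕ-pos₁ l))))
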